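{- Let $\lambda\geq 4$ and $m>n$ be positive integers with $m$ and $n$ both odd, and suppose $3\mid\lambda mn$, $2\mid n-1+\lambda m$ and $2\mid m-1+\lambda n$. If $\lambda\leq\left\lfloor 3\left(\frac{m-1}{n}\right)\right\rfloor$, then a $\mathrm{GDD}(m,n;3,\lambda)$ exists.
   Context: A group divisible design $\mathrm{GDD}(m,n;\lambda_1,\lambda_2)$ is a pair $(V,\mathcal{B})$ where $V=M\cup N$ with $M,N$ disjoint, $|M|=m$, $|N|=n$ (the two groups), and $\mathcal{B}$ is a collection (repetitions allowed) of 3-element subsets (blocks) of $V$ such that each pair of distinct symbols in the same group lies in exactly $\lambda_1$ blocks and each pair of symbols from different groups lies in exactly $\lambda_2$ blocks. -}

module Defs where

open import Data.Nat using (ℕ; _<_; _+_)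
open import Data.Nat.Properties using (_<?_)
open import Data.Fin using (Fin; toℕ)
open import Data.Fin.Properties using (_≟_)
open import Data.List using (List; length; filter)
open import Data.Product using (_×_; _,_)
open import Data.Sum using (_⊎_)
open import Relation.Nullary using (¬_; Dec; yes; no)
open import Relation.Nullary.Decidable using (_×-dec_; _⊎-dec_; ¬?)
open import Relation.Binary.PropositionalEquality using (_≡_)

record Block (v : ℕ) : Set where
  constructor block
  field
    p₁ p₂ p₃ : Fin v
    d₁₂ : ¬ p₁ ≡ p₂
    d₁₃ : ¬ p₁ ≡ p₃
    d₂₃ : ¬ p₂ ≡ p₃

open Block public

_∈B_ : {v : ℕ} → Fin v → Block v → Set
x ∈B B = (x ≡ p₁ B ⊎ x ≡ p₂ B) ⊎ x ≡ p₃ B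

_∈B?_ : {v : ℕ} → (x : Fin v) → (B : Block v) → Dec (x ∈B B)
x ∈B? B = ((x ≟ p₁ B) ⊎-dec (x ≟ p₂ B)) ⊎-dec (x ≟ p₃ B)

pairCount : {v : ℕ} → List (Block v) → Fin v → Fin v → ℕ
pairCount 𝓑 x y = length (filter (λ B → (x ∈B? B) ×-dec (y ∈B? B)) 𝓑)

-- Point set V = Fin (m + n); group M = points with index < m,
-- group N = points with index ≥ m.
sameGroup : (m n : ℕ) → Fin (m + n) → Fin (m + n) → Set
sameGroup m n x y = (toℕ x < m × toℕ y < m) ⊎ (¬ toℕ x < m × ¬ toℕ y < m)

IsGDD : (m n λ₁ λ₂ : ℕ) → List (Block (m + n)) → Set
IsGDD m n λ₁ λ₂ 𝓑 =
  (x y : Fin (m + n)) → ¬ x ≡ y →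
    (sameGroup m n x y → pairCount 𝓑 x y ≡ λ₁) ×
    (¬ sameGroup m n x y → pairCount 𝓑 x y ≡ λ₂)

module Submission where

-- Write m = 2k + 1, n = 2l + 1, λ = 2h, and put ℤ_m on M and ℤ_n on N. The development of the
-- base block {0, d, 2d} over ℤ_v covers the pairs at cyclic distance ±d twice and those at ±2d
-- once; as d runs over 1, …, k, both ±d and ±2d run over the nonzero elements of ℤ_(2k+1) exactly
-- once, so the developments for d = 1, …, l give index 3 inside N. Mixed pairs are covered by nh
-- "edge families" {t, t + e, z} (t ∈ ℤ_m), h for each apex z ∈ N, each covering every pair {x, z}
-- with x ∈ M twice. An edge family of difference e also covers the pairs of M at distance ±e once,
-- so three edge families with differences d, d, 2d replace the development for d; the bound
-- λ ≤ ⌊3(m − 1)/n⌋, i.e. nh ≤ 3k, ensures there are enough differences. Writing nh = 3c + r + 1, the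
-- last r + 1 ≤ 3 edge families use d₀ = m/3 when 3 ∣ m, and 2 − r copies of the short orbit of
-- {0, d₀, 2d₀} (which covers ±d₀ once) complete the count; when 3 ∤ m, 3 ∣ nh, so r = 2 and nothing
-- needs completing.

open import Defs
open import Data.Nat
open import Data.Nat.Properties
open import Data.Nat.DivMod
open import Data.Nat.Divisibility
open import Data.Nat.Primality using (Prime; prime?; euclidsLemma)
open import Data.Nat.Solver using (module +-*-Solver)
open import Data.Fin using (Fin; toℕ; fromℕ<)
open import Data.Fin.Properties using (toℕ<n; toℕ-fromℕ<; toℕ-injective) renaming (_≟_ to _≟ᶠ_)
open import Data.List using (List; []; _∷_; _++_; length; filter)
open import Data.List.Properties using (length-++; filter-++; filter-accept; filter-reject)
open import Data.Product using (Σ; _×_; _,_; proj₁; proj₂)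
open import Data.Sum using (_⊎_; inj₁; inj₂)
open import Data.Empty using (⊥; ⊥-elim)
open import Function using (_∘′_)
open import Relation.Nullary using (¬_; Dec; yes; no)
open import Relation.Nullary.Decidable using (_×-dec_; _⊎-dec_; toWitness)
open import Relation.Binary.PropositionalEquality
open +-*-Solver

𝟙 : {P : Set} → Dec P → ℕ
𝟙 (yes _) = 1
𝟙 (no _) = 0

𝟙-yes : {P : Set} (p : Dec P) → P → 𝟙 p ≡ 1
𝟙-yes (yes _) _ = refl
𝟙-yes (no ¬p) p = ⊥-elim (¬p p)

𝟙-no : {P : Set} (p : Dec P) → ¬ P → 𝟙 p ≡ 0
𝟙-no (yes p) ¬p = ⊥-elim (¬p p)
𝟙-no (no _) _ = refl

module _ {P Q : Set} where

  𝟙-⇔ : (p : Dec P) (q : Dec Q) → (P → Q) → (Q → P) → 𝟙 p ≡ 𝟙 q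
  𝟙-⇔ (yes p) q f _ = sym (𝟙-yes q (f p))
  𝟙-⇔ (no ¬p) q _ g = sym (𝟙-no q (λ z → ¬p (g z)))

  𝟙-× : (p : Dec P) (q : Dec Q) → 𝟙 (p ×-dec q) ≡ 𝟙 p * 𝟙 q
  𝟙-× (yes _) (yes _) = refl
  𝟙-× (yes _) (no _) = refl
  𝟙-× (no _) _ = refl

  𝟙-⊎ : (p : Dec P) (q : Dec Q) → (P → ¬ Q) → 𝟙 (p ⊎-dec q) ≡ 𝟙 p + 𝟙 q
  𝟙-⊎ (yes p) (yes q) disj = ⊥-elim (disj p q)
  𝟙-⊎ (yes _) (no _) _ = refl
  𝟙-⊎ (no _) (yes _) _ = refl
  𝟙-⊎ (no _) (no _) _ = refl

δ : ℕ → ℕ → ℕ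
δ a b = 𝟙 (a ≟ b)

δ-refl : ∀ a → δ a a ≡ 1
δ-refl a = 𝟙-yes (a ≟ a) refl

δ-≢ : ∀ {a b} → a ≢ b → δ a b ≡ 0
δ-≢ {a} {b} = 𝟙-no (a ≟ b)

δ-⇔ : ∀ {a b c d} → (a ≡ b → c ≡ d) → (c ≡ d → a ≡ b) → δ a b ≡ δ c d
δ-⇔ {a} {b} {c} {d} = 𝟙-⇔ (a ≟ b) (c ≟ d)

δ-+ˡ : ∀ o a b → δ (o + a) (o + b) ≡ δ a b
δ-+ˡ o a b = δ-⇔ (+-cancelˡ-≡ o a b) (cong (o +_))

δ*δ-≢ : ∀ {x y} → x ≢ y → ∀ s → δ x s * δ y s ≡ 0
δ*δ-≢ {x} {y} x≢y s with x ≟ s | y ≟ s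
... | yes refl | yes refl = ⊥-elim (x≢y refl)
... | yes _ | no _ = refl
... | no _ | _ = refl

-- Finite sums

∑ : ℕ → (ℕ → ℕ) → ℕ
∑ zero f = 0
∑ (suc n) f = ∑ n f + f n

∑-cong : ∀ n {f g : ℕ → ℕ} → (∀ t → t < n → f t ≡ g t) → ∑ n f ≡ ∑ n g
∑-cong zero eq = refl
∑-cong (suc n) eq = cong₂ _+_ (∑-cong n (λ t t<n → eq t (m<n⇒m<1+n t<n))) (eq n ≤-refl)

∑-distrib-+ : ∀ n (f g : ℕ → ℕ) → ∑ n (λ t → f t + g t) ≡ ∑ n f + ∑ n g
∑-distrib-+ zero f g = refl
∑-distrib-+ (suc n) f g rewrite ∑-distrib-+ n f g =
  solve 4 (λ a b c d → (a :+ b) :+ (c :+ d) := (a :+ c) :+ (b :+ d)) refl (∑ n f) (∑ n g) (f n) (g n)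

∑-*ˡ : ∀ n c (f : ℕ → ℕ) → ∑ n (λ t → c * f t) ≡ c * ∑ n f
∑-*ˡ zero c f = sym (*-zeroʳ c)
∑-*ˡ (suc n) c f rewrite ∑-*ˡ n c f = sym (*-distribˡ-+ c (∑ n f) (f n))

∑-const : ∀ n c → ∑ n (λ _ → c) ≡ n * c
∑-const zero c = refl
∑-const (suc n) c rewrite ∑-const n c = +-comm (n * c) c

∑-zero : ∀ n {f : ℕ → ℕ} → (∀ t → t < n → f t ≡ 0) → ∑ n f ≡ 0
∑-zero n eq = trans (∑-cong n eq) (trans (∑-const n 0) (*-zeroʳ n))

∑-+ : ∀ a b (f : ℕ → ℕ) → ∑ (a + b) f ≡ ∑ a f + ∑ b (λ i → f (a + i))
∑-+ a zero f rewrite +-identityʳ a = sym (+-identityʳ _)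
∑-+ a (suc b) f rewrite +-suc a b | ∑-+ a b f = +-assoc (∑ a f) _ _

∑-head : ∀ n (f : ℕ → ℕ) → ∑ (suc n) f ≡ f 0 + ∑ n (λ i → f (suc i))
∑-head = ∑-+ 1

∑-rows : ∀ c b (f : ℕ → ℕ) → ∑ (c * b) f ≡ ∑ c (λ q → ∑ b (λ i → f (q * b + i)))
∑-rows zero b f = refl
∑-rows (suc c) b f = begin
    ∑ (b + c * b) f
  ≡⟨ cong (λ z → ∑ z f) (+-comm b (c * b)) ⟩
    ∑ (c * b + b) f
  ≡⟨ ∑-+ (c * b) b f ⟩
    ∑ (c * b) f + ∑ b (λ i → f (c * b + i))
  ≡⟨ cong (_+ ∑ b (λ i → f (c * b + i))) (∑-rows c b f) ⟩
    ∑ c (λ q → ∑ b (λ i → f (q * b + i))) + ∑ b (λ i → f (c * b + i)) ∎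
  where open ≡-Reasoning

∑-periodic : ∀ c d (f : ℕ → ℕ) → (∀ t → f (d + t) ≡ f t) → ∑ (c * d) f ≡ c * ∑ d f
∑-periodic c d f per = begin
    ∑ (c * d) f
  ≡⟨ ∑-rows c d f ⟩
    ∑ c (λ q → ∑ d (λ i → f (q * d + i)))
  ≡⟨ ∑-cong c (λ q _ → ∑-cong d (λ i _ → unroll q i)) ⟩
    ∑ c (λ _ → ∑ d f)
  ≡⟨ ∑-const c (∑ d f) ⟩
    c * ∑ d f ∎
  where
  open ≡-Reasoning
  unroll : ∀ q i → f (q * d + i) ≡ f i
  unroll zero i = refl
  unroll (suc q) i = trans (cong f (+-assoc d (q * d) i)) (trans (per (q * d + i)) (unroll q i))

∑-reverse : ∀ n (f : ℕ → ℕ) → ∑ n f ≡ ∑ n (λ i → f (n ∸ suc i))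
∑-reverse zero f = refl
∑-reverse (suc n) f = begin
    ∑ n f + f n
  ≡⟨ cong (_+ f n) (∑-reverse n f) ⟩
    ∑ n (λ i → f (n ∸ suc i)) + f n
  ≡⟨ +-comm _ (f n) ⟩
    f n + ∑ n (λ i → f (n ∸ suc i))
  ≡⟨ ∑-head n (λ i → f (suc n ∸ suc i)) ⟨
    ∑ (suc n) (λ i → f (suc n ∸ suc i)) ∎
  where open ≡-Reasoning

∑-rotate : ∀ n (f : ℕ → ℕ) → f n ≡ f 0 → ∑ n (λ i → f (suc i)) ≡ ∑ n f
∑-rotate n f wrap = +-cancelˡ-≡ (f 0) _ _ (begin
    f 0 + ∑ n (λ i → f (suc i))
  ≡⟨ ∑-head n f ⟨
    ∑ n f + f n
  ≡⟨ cong (∑ n f +_) wrap ⟩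
    ∑ n f + f 0
  ≡⟨ +-comm (∑ n f) (f 0) ⟩
    f 0 + ∑ n f ∎)
  where open ≡-Reasoning

∑-single : ∀ n t₀ (f : ℕ → ℕ) → t₀ < n → (∀ t → t < n → t ≢ t₀ → f t ≡ 0) → ∑ n f ≡ f t₀
∑-single (suc n) t₀ f t₀<1+n rest with t₀ ≟ n
... | yes refl = cong (_+ f t₀) (∑-zero n (λ t t<n → rest t (m<n⇒m<1+n t<n) (<⇒≢ t<n)))
... | no t₀≢n = trans (cong₂ _+_ (∑-single n t₀ f (≤∧≢⇒< (≤-pred t₀<1+n) t₀≢n) (λ t t<n → rest t (m<n⇒m<1+n t<n)))
                                 (rest n ≤-refl (t₀≢n ∘′ sym)))
                       (+-identityʳ (f t₀))

∑-δ : ∀ n x (g : ℕ → ℕ) → x < n → ∑ n (λ s → δ x s * g s) ≡ g x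
∑-δ n x g x<n = trans (∑-single n x _ x<n (λ s _ s≢x → cong (_* g s) (δ-≢ (s≢x ∘′ sym))))
                      (trans (cong (_* g x) (δ-refl x)) (+-identityʳ (g x)))

∑-δ₁ : ∀ n x → x < n → ∑ n (δ x) ≡ 1
∑-δ₁ n x x<n = trans (∑-cong n (λ s _ → sym (*-identityʳ (δ x s)))) (∑-δ n x (λ _ → 1) x<n)

punchIn : ℕ → ℕ → ℕ
punchIn p q with q <? p
... | yes _ = q
... | no _ = suc q

punchIn-< : ∀ {p q} → q < p → punchIn p q ≡ q
punchIn-< {p} {q} q<p with q <? p
... | yes _ = refl
... | no q≮p = ⊥-elim (q≮p q<p)

punchIn-≥ : ∀ {p q} → p ≤ q → punchIn p q ≡ suc q
punchIn-≥ {p} {q} p≤q with q <? p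
... | yes q<p = ⊥-elim (<⇒≱ q<p p≤q)
... | no _ = refl

punchIn-≤ : ∀ p q → punchIn p q ≤ suc q
punchIn-≤ p q with q <? p
... | yes _ = n≤1+n q
... | no _ = ≤-refl

∑-punchIn : ∀ p w (g : ℕ → ℕ) → ∑ (p + w) (λ q → g (punchIn p q)) + g p ≡ ∑ (suc (p + w)) g
∑-punchIn p zero g rewrite +-identityʳ p = cong (_+ g p) (∑-cong p (λ q q<p → cong g (punchIn-< q<p)))
∑-punchIn p (suc w) g rewrite +-suc p w = begin
    ∑ (p + w) (λ q → g (punchIn p q)) + g (punchIn p (p + w)) + g p
  ≡⟨ cong (λ z → ∑ (p + w) (λ q → g (punchIn p q)) + g z + g p) (punchIn-≥ (m≤m+n p w)) ⟩
    ∑ (p + w) (λ q → g (punchIn p q)) + g (suc (p + w)) + g p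
  ≡⟨ solve 3 (λ a b c → a :+ b :+ c := a :+ c :+ b) refl (∑ (p + w) (λ q → g (punchIn p q))) (g (suc (p + w))) (g p) ⟩
    ∑ (p + w) (λ q → g (punchIn p q)) + g p + g (suc (p + w))
  ≡⟨ cong (_+ g (suc (p + w))) (∑-punchIn p w g) ⟩
    ∑ (suc (suc (p + w))) g ∎
  where open ≡-Reasoning

-- The multiset of differences {d, d, 2d} realised by the base block {0, d, 2d}.
triad : ℕ → ℕ → ℕ
triad d 2 = d + d
triad d _ = d

triad-pos : ∀ {d} i → 0 < d → 0 < triad d i
triad-pos 0 0<d = 0<d
triad-pos 1 0<d = 0<d
triad-pos {d} 2 0<d = <-≤-trans 0<d (m≤m+n d d)
triad-pos (suc (suc (suc _))) 0<d = 0<d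

triad-≤ : ∀ d i → triad d i ≤ d + d
triad-≤ d 0 = m≤m+n d d
triad-≤ d 1 = m≤m+n d d
triad-≤ d 2 = ≤-refl
triad-≤ d (suc (suc (suc _))) = m≤m+n d d

∑-triad : ∀ (f : ℕ → ℕ) d → ∑ 3 (λ i → f (triad d i)) ≡ 2 * f d + f (d + d)
∑-triad f d = solve 2 (λ a b → con 0 :+ a :+ a :+ b := con 2 :* a :+ b) refl (f d) (f (d + d))

-- Replacing the missing part of the triad by copies of d costs nothing once f (2d) = f d.
∑-triad-padded : ∀ (f : ℕ → ℕ) d r → r ≤ 2 → (r < 2 → f (d + d) ≡ f d) →
  (2 ∸ r) * f d + ∑ (suc r) (λ i → f (triad d i)) ≡ 2 * f d + f (d + d)
∑-triad-padded f d 0 _ f2d≡fd rewrite f2d≡fd (s≤s z≤n) =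
  solve 1 (λ a → con 2 :* a :+ (con 0 :+ a) := con 2 :* a :+ a) refl (f d)
∑-triad-padded f d 1 _ f2d≡fd rewrite f2d≡fd (s≤s (s≤s z≤n)) =
  solve 1 (λ a → con 1 :* a :+ (con 0 :+ a :+ a) := con 2 :* a :+ a) refl (f d)
∑-triad-padded f d 2 _ _ = ∑-triad f d
∑-triad-padded f d (suc (suc (suc _))) (s≤s (s≤s ())) _

m+n≡o⇒o∸n≡m : ∀ {m n o} → m + n ≡ o → o ∸ n ≡ m
m+n≡o⇒o∸n≡m {m} {n} refl = m+n∸n≡m m n

-- Arithmetic in ℤ_v

module Cyclic (v : ℕ) .{{_ : NonZero v}} where

  [m%v+n]%v≡[m+n]%v : ∀ m n → (m % v + n) % v ≡ (m + n) % v
  [m%v+n]%v≡[m+n]%v m n = begin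
      (m % v + n) % v
    ≡⟨ %-distribˡ-+ (m % v) n v ⟩
      (m % v % v + n % v) % v
    ≡⟨ cong (λ z → (z + n % v) % v) (m%n%n≡m%n m v) ⟩
      (m % v + n % v) % v
    ≡⟨ %-distribˡ-+ m n v ⟨
      (m + n) % v ∎
    where open ≡-Reasoning

  [m+n+[v∸n%v]]%v≡m%v : ∀ m n → (m + n + (v ∸ n % v)) % v ≡ m % v
  [m+n+[v∸n%v]]%v≡m%v m n = begin
      (m + n + (v ∸ n % v)) % v
    ≡⟨ cong (λ z → (m + z + (v ∸ n % v)) % v) (m≡m%n+[m/n]*n n v) ⟩
      (m + (n % v + n / v * v) + (v ∸ n % v)) % v
    ≡⟨ cong (_% v) (solve 4 (λ m r q w → m :+ (r :+ q) :+ w := m :+ (r :+ w) :+ q) refl m (n % v) (n / v * v) (v ∸ n % v)) ⟩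
      (m + (n % v + (v ∸ n % v)) + n / v * v) % v
    ≡⟨ [m+kn]%n≡m%n (m + (n % v + (v ∸ n % v))) (n / v) v ⟩
      (m + (n % v + (v ∸ n % v))) % v
    ≡⟨ cong (λ z → (m + z) % v) (m+[n∸m]≡n (m%n≤n n v)) ⟩
      (m + v) % v
    ≡⟨ [m+n]%n≡m%n m v ⟩
      m % v ∎
    where open ≡-Reasoning

  %-cancelʳ-+ : ∀ a b c → (a + c) % v ≡ (b + c) % v → a % v ≡ b % v
  %-cancelʳ-+ a b c eq = begin
      a % v
    ≡⟨ [m+n+[v∸n%v]]%v≡m%v a c ⟨
      (a + c + w) % v
    ≡⟨ [m%v+n]%v≡[m+n]%v (a + c) w ⟨
      ((a + c) % v + w) % v
    ≡⟨ cong (λ z → (z + w) % v) eq ⟩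
      ((b + c) % v + w) % v
    ≡⟨ [m%v+n]%v≡[m+n]%v (b + c) w ⟩
      (b + c + w) % v
    ≡⟨ [m+n+[v∸n%v]]%v≡m%v b c ⟩
      b % v ∎
    where
    open ≡-Reasoning
    w = v ∸ c % v

  translate-injective : ∀ t {a b} → a < v → b < v → (t + a) % v ≡ (t + b) % v → a ≡ b
  translate-injective t {a} {b} a<v b<v eq = begin
      a
    ≡⟨ m<n⇒m%n≡m a<v ⟨
      a % v
    ≡⟨ %-cancelʳ-+ a b t (trans (cong (_% v) (+-comm a t)) (trans eq (cong (_% v) (+-comm t b)))) ⟩
      b % v
    ≡⟨ m<n⇒m%n≡m b<v ⟩
      b ∎
    where open ≡-Reasoning

  ∑-translate : ∀ a (f : ℕ → ℕ) → ∑ v (λ t → f ((t + a) % v)) ≡ ∑ v f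
  ∑-translate zero f = ∑-cong v (λ t t<v → cong f (trans (cong (_% v) (+-identityʳ t)) (m<n⇒m%n≡m t<v)))
  ∑-translate (suc a) f = begin
      ∑ v (λ t → f ((t + suc a) % v))
    ≡⟨ ∑-cong v (λ t _ → cong (λ z → f (z % v)) (+-suc t a)) ⟩
      ∑ v (λ t → g (suc t))
    ≡⟨ ∑-rotate v g (cong f (trans (cong (_% v) (+-comm v a)) ([m+n]%n≡m%n a v))) ⟩
      ∑ v g
    ≡⟨ ∑-translate a f ⟩
      ∑ v f ∎
    where
    open ≡-Reasoning
    g : ℕ → ℕ
    g t = f ((t + a) % v)

  Δ : ℕ → ℕ → ℕ → ℕ
  Δ e x y = δ y ((x + e) % v)

  Δ± : ℕ → ℕ → ℕ → ℕ
  Δ± e x y = Δ e x y + Δ e y x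

  ∑-δ-translate₁ : ∀ {x} a → x < v → ∑ v (λ t → δ x ((t + a) % v)) ≡ 1
  ∑-δ-translate₁ {x} a x<v = trans (∑-translate a (δ x)) (∑-δ₁ v x x<v)

  ∑-δ-translate : ∀ {x y} a e → x < v →
    ∑ v (λ t → δ x ((t + a) % v) * δ y ((t + (a + e)) % v)) ≡ Δ e x y
  ∑-δ-translate {x} {y} a e x<v = begin
      ∑ v (λ t → δ x ((t + a) % v) * δ y ((t + (a + e)) % v))
    ≡⟨ ∑-cong v (λ t _ → cong (λ z → δ x ((t + a) % v) * δ y z) (regroup t)) ⟩
      ∑ v (λ t → g ((t + a) % v))
    ≡⟨ ∑-translate a g ⟩
      ∑ v g
    ≡⟨ ∑-δ v x (λ s → δ y ((s + e) % v)) x<v ⟩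
      Δ e x y ∎
    where
    open ≡-Reasoning
    g : ℕ → ℕ
    g s = δ x s * δ y ((s + e) % v)
    regroup : ∀ t → (t + (a + e)) % v ≡ ((t + a) % v + e) % v
    regroup t = trans (cong (_% v) (sym (+-assoc t a e))) (sym ([m%v+n]%v≡[m+n]%v (t + a) e))

  ∑-δ-translate-+ : ∀ {p q p′ q′} → p < v → p′ < v → ∀ a e a′ e′ →
    ∑ v (λ t → δ p ((t + a) % v) * δ q ((t + (a + e)) % v) + δ p′ ((t + a′) % v) * δ q′ ((t + (a′ + e′)) % v))
    ≡ Δ e p q + Δ e′ p′ q′
  ∑-δ-translate-+ p<v p′<v a e a′ e′ =
    trans (∑-distrib-+ v _ _) (cong₂ _+_ (∑-δ-translate a e p<v) (∑-δ-translate a′ e′ p′<v))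

  Δ-flip : ∀ {e x y} → e ≤ v → x < v → y < v → Δ e y x ≡ Δ (v ∸ e) x y
  Δ-flip {e} {x} {y} e≤v x<v y<v =
    δ-⇔ (λ eq → sym (undo eq (m+[n∸m]≡n e≤v) y<v)) (λ eq → sym (undo eq (m∸n+n≡m e≤v) x<v))
    where
    undo : ∀ {a b f f′} → a ≡ (b + f) % v → f + f′ ≡ v → b < v → (a + f′) % v ≡ b
    undo {a} {b} {f} {f′} refl f+f′≡v b<v = begin
        ((b + f) % v + f′) % v
      ≡⟨ [m%v+n]%v≡[m+n]%v (b + f) f′ ⟩
        (b + f + f′) % v
      ≡⟨ cong (_% v) (trans (+-assoc b f f′) (cong (b +_) f+f′≡v)) ⟩
        (b + v) % v
      ≡⟨ [m+n]%n≡m%n b v ⟩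
        b % v
      ≡⟨ m<n⇒m%n≡m b<v ⟩
        b ∎
      where open ≡-Reasoning

  Δ±-double : ∀ {d x y} → d + d + d ≡ v → x < v → y < v → Δ± (d + d) x y ≡ Δ± d x y
  Δ±-double {d} {x} {y} 3d≡v x<v y<v =
    trans (cong₂ _+_ (Δ-2d x<v y<v) (Δ-2d y<v x<v)) (+-comm (Δ d y x) (Δ d x y))
    where
    Δ-2d : ∀ {p q} → p < v → q < v → Δ (d + d) p q ≡ Δ d q p
    Δ-2d {p} {q} p<v q<v = begin
        Δ (d + d) p q
      ≡⟨ cong (λ e → Δ e p q) (m+n≡o⇒o∸n≡m 3d≡v) ⟨
        Δ (v ∸ d) p q
      ≡⟨ Δ-flip (subst (d ≤_) 3d≡v (m≤n+m d (d + d))) p<v q<v ⟨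
        Δ d q p ∎
      where open ≡-Reasoning

  ∑-Δ : ∀ {x y} → x < v → y < v → x ≢ y → ∑ (pred v) (λ e → Δ (suc e) x y) ≡ 1
  ∑-Δ {x} {y} x<v y<v x≢y = begin
      ∑ (pred v) (λ e → Δ (suc e) x y)
    ≡⟨ cong (_+ ∑ (pred v) (λ e → Δ (suc e) x y)) Δ₀≡0 ⟨
      Δ 0 x y + ∑ (pred v) (λ e → Δ (suc e) x y)
    ≡⟨ ∑-head (pred v) (λ e → Δ e x y) ⟨
      ∑ (suc (pred v)) (λ e → Δ e x y)
    ≡⟨ cong (λ n → ∑ n (λ e → Δ e x y)) (suc-pred v) ⟩
      ∑ v (λ e → Δ e x y)
    ≡⟨ ∑-cong v (λ e _ → cong (λ z → δ y (z % v)) (+-comm x e)) ⟩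
      ∑ v (λ e → δ y ((e + x) % v))
    ≡⟨ ∑-δ-translate₁ x y<v ⟩
      1 ∎
    where
    open ≡-Reasoning
    Δ₀≡0 : Δ 0 x y ≡ 0
    Δ₀≡0 = δ-≢ (λ eq → x≢y (sym (trans eq (trans (cong (_% v) (+-identityʳ x)) (m<n⇒m%n≡m x<v)))))

-- Each nonzero difference modulo 2K+1 is ±d for exactly one d ∈ [1, K], and likewise ±2d.

module OddCycle (K : ℕ) where

  v : ℕ
  v = suc (K + K)

  open Cyclic v

  private
    ∑-Δ-mirror : ∀ {x y} (e e′ : ℕ → ℕ) → x < v → y < v →
      (∀ d → d < K → e d ≤ v) → (∀ d → d < K → e′ d + e (K ∸ suc d) ≡ v) →
      ∑ K (λ d → Δ (e d) y x) ≡ ∑ K (λ d → Δ (e′ d) x y)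
    ∑-Δ-mirror {x} {y} e e′ x<v y<v e≤v mirror = begin
        ∑ K (λ d → Δ (e d) y x)
      ≡⟨ ∑-cong K (λ d d<K → Δ-flip (e≤v d d<K) x<v y<v) ⟩
        ∑ K (λ d → Δ (v ∸ e d) x y)
      ≡⟨ ∑-reverse K _ ⟩
        ∑ K (λ d → Δ (v ∸ e (K ∸ suc d)) x y)
      ≡⟨ ∑-cong K (λ d d<K → cong (λ z → Δ z x y) (m+n≡o⇒o∸n≡m (mirror d d<K))) ⟩
        ∑ K (λ d → Δ (e′ d) x y) ∎
      where open ≡-Reasoning

    complement : ∀ {d} → d < K → (K ∸ suc d) + suc d ≡ K
    complement = m∸n+n≡m

  ∑-Δ±₁ : ∀ {x y} → x < v → y < v → x ≢ y → ∑ K (λ d → Δ± (suc d) x y) ≡ 1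
  ∑-Δ±₁ {x} {y} x<v y<v x≢y = begin
      ∑ K (λ d → Δ (suc d) x y + Δ (suc d) y x)
    ≡⟨ ∑-distrib-+ K _ _ ⟩
      ∑ K (λ d → Δ (suc d) x y) + ∑ K (λ d → Δ (suc d) y x)
    ≡⟨ cong (∑ K (λ d → Δ (suc d) x y) +_) (∑-Δ-mirror suc (λ d → suc (K + d)) x<v y<v bound mirror) ⟩
      ∑ K (λ d → Δ (suc d) x y) + ∑ K (λ d → Δ (suc (K + d)) x y)
    ≡⟨ ∑-+ K K (λ e → Δ (suc e) x y) ⟨
      ∑ (K + K) (λ e → Δ (suc e) x y)
    ≡⟨ ∑-Δ x<v y<v x≢y ⟩
      1 ∎
    where
    open ≡-Reasoning
    bound : ∀ d → d < K → suc d ≤ v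
    bound d d<K = ≤-trans d<K (≤-trans (m≤m+n K K) (n≤1+n _))
    mirror : ∀ d → d < K → suc (K + d) + suc (K ∸ suc d) ≡ v
    mirror d d<K = trans
      (solve 3 (λ k d w → con 1 :+ (k :+ d) :+ (con 1 :+ w) := con 1 :+ (k :+ (w :+ (con 1 :+ d)))) refl K d (K ∸ suc d))
      (cong (λ z → suc (K + z)) (complement d<K))

  ∑-Δ±₂ : ∀ {x y} → x < v → y < v → x ≢ y → ∑ K (λ d → Δ± (suc d + suc d) x y) ≡ 1
  ∑-Δ±₂ {x} {y} x<v y<v x≢y = begin
      ∑ K (λ d → Δ (suc d + suc d) x y + Δ (suc d + suc d) y x)
    ≡⟨ ∑-distrib-+ K _ _ ⟩
      ∑ K (λ d → Δ (suc d + suc d) x y) + ∑ K (λ d → Δ (suc d + suc d) y x)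
    ≡⟨ cong (∑ K (λ d → Δ (suc d + suc d) x y) +_) (∑-Δ-mirror (λ d → suc d + suc d) (λ d → suc (d + d)) x<v y<v bound mirror) ⟩
      ∑ K (λ d → Δ (suc d + suc d) x y) + ∑ K (λ d → Δ (suc (d + d)) x y)
    ≡⟨ +-comm (∑ K (λ d → Δ (suc d + suc d) x y)) _ ⟩
      ∑ K (λ d → Δ (suc (d + d)) x y) + ∑ K (λ d → Δ (suc d + suc d) x y)
    ≡⟨ ∑-distrib-+ K _ _ ⟨
      ∑ K (λ d → Δ (suc (d + d)) x y + Δ (suc d + suc d) x y)
    ≡⟨ ∑-cong K (λ d _ → cong₂ (λ a b → Δ (suc a) x y + Δ (suc b) x y) (evens d) (odds d)) ⟩
      ∑ K (λ d → 0 + Δ (suc (d * 2 + 0)) x y + Δ (suc (d * 2 + 1)) x y)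
    ≡⟨ ∑-rows K 2 (λ e → Δ (suc e) x y) ⟨
      ∑ (K * 2) (λ e → Δ (suc e) x y)
    ≡⟨ cong (λ n → ∑ n (λ e → Δ (suc e) x y)) (trans (*-comm K 2) (cong (K +_) (+-identityʳ K))) ⟩
      ∑ (K + K) (λ e → Δ (suc e) x y)
    ≡⟨ ∑-Δ x<v y<v x≢y ⟩
      1 ∎
    where
    open ≡-Reasoning
    evens : ∀ d → d + d ≡ d * 2 + 0
    evens = solve 1 (λ d → d :+ d := d :* con 2 :+ con 0) refl
    odds : ∀ d → d + suc d ≡ d * 2 + 1
    odds = solve 1 (λ d → d :+ (con 1 :+ d) := d :* con 2 :+ con 1) refl
    bound : ∀ d → d < K → suc d + suc d ≤ v
    bound d d<K = ≤-trans (+-mono-≤ d<K d<K) (n≤1+n _)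
    mirror : ∀ d → d < K → suc (d + d) + (suc (K ∸ suc d) + suc (K ∸ suc d)) ≡ v
    mirror d d<K = trans
      (solve 2 (λ d w → con 1 :+ (d :+ d) :+ ((con 1 :+ w) :+ (con 1 :+ w)) := con 1 :+ ((w :+ (con 1 :+ d)) :+ (w :+ (con 1 :+ d)))) refl d (K ∸ suc d))
      (cong (λ z → suc (z + z)) (complement d<K))

occ : ℕ → ℕ → ℕ → ℕ → ℕ
occ a b c z = δ z a + δ z b + δ z c

module _ {V : ℕ} where

  pairCount-++ : ∀ (𝓐 𝓑 : List (Block V)) x y → pairCount (𝓐 ++ 𝓑) x y ≡ pairCount 𝓐 x y + pairCount 𝓑 x y
  pairCount-++ 𝓐 𝓑 x y = trans (cong length (filter-++ _ 𝓐 𝓑)) (length-++ (filter _ 𝓐))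

  pairCount-single : ∀ B (x y : Fin V) → pairCount (B ∷ []) x y ≡ 𝟙 (x ∈B? B) * 𝟙 (y ∈B? B)
  pairCount-single B x y with (x ∈B? B) ×-dec (y ∈B? B) in eq
  ... | yes p = trans (cong length (filter-accept (λ B → (x ∈B? B) ×-dec (y ∈B? B)) p))
                      (trans (cong 𝟙 (sym eq)) (𝟙-× (x ∈B? B) (y ∈B? B)))
  ... | no ¬p = trans (cong length (filter-reject (λ B → (x ∈B? B) ×-dec (y ∈B? B)) ¬p))
                      (trans (cong 𝟙 (sym eq)) (𝟙-× (x ∈B? B) (y ∈B? B)))

  pairCount-sym : ∀ 𝓑 (x y : Fin V) → pairCount 𝓑 x y ≡ pairCount 𝓑 y x
  pairCount-sym [] x y = refl
  pairCount-sym (B ∷ 𝓑) x y = begin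
      pairCount ((B ∷ []) ++ 𝓑) x y
    ≡⟨ pairCount-++ (B ∷ []) 𝓑 x y ⟩
      pairCount (B ∷ []) x y + pairCount 𝓑 x y
    ≡⟨ cong₂ _+_ (trans (pairCount-single B x y) (trans (*-comm (𝟙 (x ∈B? B)) _) (sym (pairCount-single B y x)))) (pairCount-sym 𝓑 x y) ⟩
      pairCount (B ∷ []) y x + pairCount 𝓑 y x
    ≡⟨ pairCount-++ (B ∷ []) 𝓑 y x ⟨
      pairCount ((B ∷ []) ++ 𝓑) y x ∎
    where open ≡-Reasoning

  𝟙-∈B : ∀ (x : Fin V) B → 𝟙 (x ∈B? B) ≡ occ (toℕ (p₁ B)) (toℕ (p₂ B)) (toℕ (p₃ B)) (toℕ x)
  𝟙-∈B x B = begin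
      𝟙 (x ∈B? B)
    ≡⟨ 𝟙-⊎ ((x ≟ᶠ p₁ B) ⊎-dec (x ≟ᶠ p₂ B)) (x ≟ᶠ p₃ B) not-p₃ ⟩
      𝟙 ((x ≟ᶠ p₁ B) ⊎-dec (x ≟ᶠ p₂ B)) + 𝟙 (x ≟ᶠ p₃ B)
    ≡⟨ cong (_+ 𝟙 (x ≟ᶠ p₃ B)) (𝟙-⊎ (x ≟ᶠ p₁ B) (x ≟ᶠ p₂ B) (λ e₁ e₂ → d₁₂ B (trans (sym e₁) e₂))) ⟩
      𝟙 (x ≟ᶠ p₁ B) + 𝟙 (x ≟ᶠ p₂ B) + 𝟙 (x ≟ᶠ p₃ B)
    ≡⟨ cong₂ _+_ (cong₂ _+_ (toℕ-δ (p₁ B)) (toℕ-δ (p₂ B))) (toℕ-δ (p₃ B)) ⟩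
      δ (toℕ x) (toℕ (p₁ B)) + δ (toℕ x) (toℕ (p₂ B)) + δ (toℕ x) (toℕ (p₃ B)) ∎
    where
    open ≡-Reasoning
    toℕ-δ : ∀ p → 𝟙 (x ≟ᶠ p) ≡ δ (toℕ x) (toℕ p)
    toℕ-δ p = 𝟙-⇔ (x ≟ᶠ p) (toℕ x ≟ toℕ p) (cong toℕ) toℕ-injective
    not-p₃ : x ≡ p₁ B ⊎ x ≡ p₂ B → x ≢ p₃ B
    not-p₃ (inj₁ e₁) e₃ = d₁₃ B (trans (sym e₁) e₃)
    not-p₃ (inj₂ e₂) e₃ = d₂₃ B (trans (sym e₂) e₃)

  pairCount-block : ∀ {a b c} B → toℕ (p₁ B) ≡ a → toℕ (p₂ B) ≡ b → toℕ (p₃ B) ≡ c → ∀ (x y : Fin V) →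
    pairCount (B ∷ []) x y ≡ occ a b c (toℕ x) * occ a b c (toℕ y)
  pairCount-block B refl refl refl x y = trans (pairCount-single B x y) (cong₂ _*_ (𝟙-∈B x B) (𝟙-∈B y B))

-- Junk value: the list is empty unless a, b, c are distinct points below V.
triple : (V a b c : ℕ) → List (Block V)
triple V a b c with a <? V | b <? V | c <? V | a ≟ b | a ≟ c | b ≟ c
... | yes a<V | yes b<V | yes c<V | no a≢b | no a≢c | no b≢c =
  block (fromℕ< a<V) (fromℕ< b<V) (fromℕ< c<V) (distinct a<V b<V a≢b) (distinct a<V c<V a≢c) (distinct b<V c<V b≢c) ∷ []
  where
  distinct : ∀ {p q} (p<V : p < V) (q<V : q < V) → p ≢ q → fromℕ< p<V ≢ fromℕ< q<V
  distinct {p} {q} p<V q<V p≢q eq = p≢q (trans (sym (toℕ-fromℕ< p<V)) (trans (cong toℕ eq) (toℕ-fromℕ< q<V)))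
... | _ | _ | _ | _ | _ | _ = []

pairCount-triple : ∀ {V a b c} → a < V → b < V → c < V → a ≢ b → a ≢ c → b ≢ c → ∀ (x y : Fin V) →
  pairCount (triple V a b c) x y ≡ occ a b c (toℕ x) * occ a b c (toℕ y)
pairCount-triple {V} {a} {b} {c} a<V b<V c<V a≢b a≢c b≢c x y
  with a <? V | b <? V | c <? V | a ≟ b | a ≟ c | b ≟ c
... | yes a<V′ | yes b<V′ | yes c<V′ | no _ | no _ | no _ =
  pairCount-block _ (toℕ-fromℕ< a<V′) (toℕ-fromℕ< b<V′) (toℕ-fromℕ< c<V′) x y
... | no ¬a<V | _ | _ | _ | _ | _ = ⊥-elim (¬a<V a<V)
... | yes _ | no ¬b<V | _ | _ | _ | _ = ⊥-elim (¬b<V b<V)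
... | yes _ | yes _ | no ¬c<V | _ | _ | _ = ⊥-elim (¬c<V c<V)
... | yes _ | yes _ | yes _ | yes a≡b | _ | _ = ⊥-elim (a≢b a≡b)
... | yes _ | yes _ | yes _ | no _ | yes a≡c | _ = ⊥-elim (a≢c a≡c)
... | yes _ | yes _ | yes _ | no _ | no _ | yes b≡c = ⊥-elim (b≢c b≡c)

concatUpTo : ∀ {V} → ℕ → (ℕ → List (Block V)) → List (Block V)
concatUpTo zero f = []
concatUpTo (suc n) f = concatUpTo n f ++ f n

pairCount-concatUpTo : ∀ {V} n (f : ℕ → List (Block V)) x y →
  pairCount (concatUpTo n f) x y ≡ ∑ n (λ t → pairCount (f t) x y)
pairCount-concatUpTo zero f x y = refl
pairCount-concatUpTo (suc n) f x y =
  trans (pairCount-++ (concatUpTo n f) (f n) x y) (cong (_+ pairCount (f n) x y) (pairCount-concatUpTo n f x y))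

occ-+ˡ : ∀ o a b c z → occ (o + a) (o + b) (o + c) (o + z) ≡ occ a b c z
occ-+ˡ o a b c z = cong₂ _+_ (cong₂ _+_ (δ-+ˡ o z a) (δ-+ˡ o z b)) (δ-+ˡ o z c)

occ-rotate : ∀ a b c z → occ a b c z ≡ occ b c a z
occ-rotate a b c z = solve 3 (λ p q r → p :+ q :+ r := q :+ r :+ p) refl (δ z a) (δ z b) (δ z c)

occ-≢ : ∀ {a b c z} → z ≢ a → z ≢ b → z ≢ c → occ a b c z ≡ 0
occ-≢ z≢a z≢b z≢c rewrite δ-≢ z≢a | δ-≢ z≢b | δ-≢ z≢c = refl

-- Developments of the base block {0, d, 2d} of ℤ_v, placed on the points o, …, o + v − 1

module Development (V v : ℕ) .{{_ : NonZero v}} (o d : ℕ) where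

  open Cyclic v

  base : ℕ → List (Block V)
  base t = triple V (o + (t + 0) % v) (o + (t + d) % v) (o + (t + (d + d)) % v)

  orbit : List (Block V)
  orbit = concatUpTo v base

  occ-base : ℕ → ℕ → ℕ
  occ-base t = occ ((t + 0) % v) ((t + d) % v) ((t + (d + d)) % v)

  shortOrbit : List (Block V)
  shortOrbit = concatUpTo d base

  module _ (o+v≤V : o + v ≤ V) (0<d : 0 < d) (2d<v : d + d < v) where

    pairCount-base : ∀ t (x y : Fin V) →
      pairCount (base t) x y ≡ occ (o + (t + 0) % v) (o + (t + d) % v) (o + (t + (d + d)) % v) (toℕ x) *
                               occ (o + (t + 0) % v) (o + (t + d) % v) (o + (t + (d + d)) % v) (toℕ y)
    pairCount-base t = pairCount-triple (in-range 0) (in-range d) (in-range (d + d))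
      (apart 0<v d<v (<⇒≢ 0<d)) (apart 0<v 2d<v (<⇒≢ (<-≤-trans 0<d (m≤m+n d d))))
      (apart d<v 2d<v (λ eq → <⇒≢ 0<d (+-cancelˡ-≡ d 0 d (trans (+-identityʳ d) eq))))
      where
      d<v : d < v
      d<v = ≤-<-trans (m≤m+n d d) 2d<v
      0<v : 0 < v
      0<v = <-trans 0<d d<v
      in-range : ∀ a → o + (t + a) % v < V
      in-range a = <-≤-trans (+-monoʳ-< o (m%n<n (t + a) v)) o+v≤V
      apart : ∀ {a b} → a < v → b < v → a ≢ b → o + (t + a) % v ≢ o + (t + b) % v
      apart a<v b<v a≢b eq = a≢b (translate-injective t a<v b<v (+-cancelˡ-≡ o _ _ eq))

    pairCount-base-shifted : ∀ t {x′ y′} (x y : Fin V) → toℕ x ≡ o + x′ → toℕ y ≡ o + y′ →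
      pairCount (base t) x y ≡ occ-base t x′ * occ-base t y′
    pairCount-base-shifted t {x′} {y′} x y x≡o+x′ y≡o+y′ = trans (pairCount-base t x y)
      (cong₂ _*_ (unshift x≡o+x′) (unshift y≡o+y′))
      where
      unshift : ∀ {z z′} → z ≡ o + z′ →
        occ (o + (t + 0) % v) (o + (t + d) % v) (o + (t + (d + d)) % v) z ≡ occ-base t z′
      unshift {z′ = z′} refl = occ-+ˡ o ((t + 0) % v) ((t + d) % v) ((t + (d + d)) % v) z′

    pairCount-orbit : ∀ {x′ y′} (x y : Fin V) → toℕ x ≡ o + x′ → toℕ y ≡ o + y′ → x′ < v → y′ < v → x′ ≢ y′ →
      pairCount orbit x y ≡ 2 * Δ± d x′ y′ + Δ± (d + d) x′ y′
    pairCount-orbit {x′} {y′} x y x≡o+x′ y≡o+y′ x′<v y′<v x′≢y′ = begin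
        pairCount orbit x y
      ≡⟨ pairCount-concatUpTo v base x y ⟩
        ∑ v (λ t → pairCount (base t) x y)
      ≡⟨ ∑-cong v (λ t _ → trans (pairCount-base-shifted t x y x≡o+x′ y≡o+y′) (regroup t)) ⟩
        ∑ v (λ t → (X 0 t * Y d t + X d t * Y (d + d) t) + (Y 0 t * X d t + Y d t * X (d + d) t)
                   + (X 0 t * Y (d + d) t + Y 0 t * X (d + d) t))
      ≡⟨ ∑-distrib-+ v _ _ ⟩
        ∑ v (λ t → (X 0 t * Y d t + X d t * Y (d + d) t) + (Y 0 t * X d t + Y d t * X (d + d) t))
        + ∑ v (λ t → X 0 t * Y (d + d) t + Y 0 t * X (d + d) t)
      ≡⟨ cong₂ _+_ (trans (∑-distrib-+ v _ _) (cong₂ _+_ (∑-δ-translate-+ x′<v x′<v 0 d d d) (∑-δ-translate-+ y′<v y′<v 0 d d d)))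
                   (∑-δ-translate-+ x′<v y′<v 0 (d + d) 0 (d + d)) ⟩
        (Δ d x′ y′ + Δ d x′ y′) + (Δ d y′ x′ + Δ d y′ x′) + (Δ (d + d) x′ y′ + Δ (d + d) y′ x′)
      ≡⟨ solve 4 (λ a b c e → (a :+ a) :+ (b :+ b) :+ (c :+ e) := con 2 :* (a :+ b) :+ (c :+ e)) refl
               (Δ d x′ y′) (Δ d y′ x′) (Δ (d + d) x′ y′) (Δ (d + d) y′ x′) ⟩
        2 * Δ± d x′ y′ + Δ± (d + d) x′ y′ ∎
      where
      open ≡-Reasoning
      X Y : ℕ → ℕ → ℕ
      X a t = δ x′ ((t + a) % v)
      Y a t = δ y′ ((t + a) % v)
      -- The diagonal products vanish since x′ ≢ y′; the others pair off by the difference they realise.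
      regroup : ∀ t → occ-base t x′ * occ-base t y′ ≡
        (X 0 t * Y d t + X d t * Y (d + d) t) + (Y 0 t * X d t + Y d t * X (d + d) t) + (X 0 t * Y (d + d) t + Y 0 t * X (d + d) t)
      regroup t = begin
          (X 0 t + X d t + X (d + d) t) * (Y 0 t + Y d t + Y (d + d) t)
        ≡⟨ solve 6 (λ a b c p q r → (a :+ b :+ c) :* (p :+ q :+ r)
                                     := (a :* q :+ b :* r) :+ (p :* b :+ q :* c) :+ (a :* r :+ p :* c)
                                        :+ (a :* p :+ b :* q :+ c :* r))
                 refl (X 0 t) (X d t) (X (d + d) t) (Y 0 t) (Y d t) (Y (d + d) t) ⟩
          S + (X 0 t * Y 0 t + X d t * Y d t + X (d + d) t * Y (d + d) t)
        ≡⟨ cong (S +_) (cong₂ _+_ (cong₂ _+_ (diagonal 0) (diagonal d)) (diagonal (d + d))) ⟩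
          S + 0
        ≡⟨ +-identityʳ S ⟩
          S ∎
        where
        S = (X 0 t * Y d t + X d t * Y (d + d) t) + (Y 0 t * X d t + Y d t * X (d + d) t) + (X 0 t * Y (d + d) t + Y 0 t * X (d + d) t)
        diagonal : ∀ a → X a t * Y a t ≡ 0
        diagonal a = δ*δ-≢ x′≢y′ ((t + a) % v)

    pairCount-outside : ∀ n (x y : Fin V) → toℕ x < o ⊎ o + v ≤ toℕ x → pairCount (concatUpTo n base) x y ≡ 0
    pairCount-outside n x y outside = trans (pairCount-concatUpTo n base x y) (∑-zero n (λ t _ →
      trans (pairCount-base t x y) (cong (_* occ (o + (t + 0) % v) (o + (t + d) % v) (o + (t + (d + d)) % v) (toℕ y))
                                        (occ-≢ (away t 0) (away t d) (away t (d + d))))))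
      where
      away : ∀ t a → toℕ x ≢ o + (t + a) % v
      away t a = outside-range outside
        where
        outside-range : toℕ x < o ⊎ o + v ≤ toℕ x → toℕ x ≢ o + (t + a) % v
        outside-range (inj₁ x<o) eq = <⇒≱ x<o (subst (o ≤_) (sym eq) (m≤m+n o _))
        outside-range (inj₂ o+v≤x) eq = <⇒≱ (+-monoʳ-< o (m%n<n (t + a) v)) (subst (o + v ≤_) eq o+v≤x)

    -- When 3d = v the translate of the base block by d is the same block, so the orbit has only d blocks.
    pairCount-shortOrbit : d + d + d ≡ v → ∀ {x′ y′} (x y : Fin V) → toℕ x ≡ o + x′ → toℕ y ≡ o + y′ →
      x′ < v → y′ < v → x′ ≢ y′ → pairCount shortOrbit x y ≡ Δ± d x′ y′
    pairCount-shortOrbit 3d≡v {x′} {y′} x y x≡o+x′ y≡o+y′ x′<v y′<v x′≢y′ = *-cancelˡ-≡ _ _ 3 (begin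
        3 * pairCount shortOrbit x y
      ≡⟨ cong (3 *_) (pairCount-concatUpTo d base x y) ⟩
        3 * ∑ d f
      ≡⟨ ∑-periodic 3 d f period ⟨
        ∑ (3 * d) f
      ≡⟨ cong (λ n → ∑ n f) (trans (solve 1 (λ d → con 3 :* d := d :+ d :+ d) refl d) 3d≡v) ⟩
        ∑ v f
      ≡⟨ pairCount-concatUpTo v base x y ⟨
        pairCount orbit x y
      ≡⟨ pairCount-orbit x y x≡o+x′ y≡o+y′ x′<v y′<v x′≢y′ ⟩
        2 * Δ± d x′ y′ + Δ± (d + d) x′ y′
      ≡⟨ cong (2 * Δ± d x′ y′ +_) (Δ±-double 3d≡v x′<v y′<v) ⟩
        2 * Δ± d x′ y′ + Δ± d x′ y′
      ≡⟨ solve 1 (λ a → con 2 :* a :+ a := con 3 :* a) refl (Δ± d x′ y′) ⟩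
        3 * Δ± d x′ y′ ∎)
      where
      open ≡-Reasoning
      f : ℕ → ℕ
      f t = pairCount (base t) x y
      rotate : ∀ t → (d + t + 0) % v ≡ (t + d) % v × (d + t + d) % v ≡ (t + (d + d)) % v × (d + t + (d + d)) % v ≡ (t + 0) % v
      rotate t = cong (_% v) (solve 2 (λ d t → d :+ t :+ con 0 := t :+ d) refl d t)
               , cong (_% v) (solve 2 (λ d t → d :+ t :+ d := t :+ (d :+ d)) refl d t)
               , trans (cong (_% v) (trans (solve 2 (λ d t → d :+ t :+ (d :+ d) := t :+ (d :+ d :+ d)) refl d t) (cong (t +_) 3d≡v)))
                       (trans ([m+n]%n≡m%n t v) (cong (_% v) (sym (+-identityʳ t))))
      period : ∀ t → f (d + t) ≡ f t
      period t with rotate t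
      ... | r₀ , r₁ , r₂ = begin
          f (d + t)
        ≡⟨ pairCount-base (d + t) x y ⟩
          occ (o + (d + t + 0) % v) (o + (d + t + d) % v) (o + (d + t + (d + d)) % v) (toℕ x) *
          occ (o + (d + t + 0) % v) (o + (d + t + d) % v) (o + (d + t + (d + d)) % v) (toℕ y)
        ≡⟨ cong₂ _*_ (same (toℕ x)) (same (toℕ y)) ⟩
          occ P₀ P₁ P₂ (toℕ x) * occ P₀ P₁ P₂ (toℕ y)
        ≡⟨ pairCount-base t x y ⟨
          f t ∎
        where
        P₀ = o + (t + 0) % v
        P₁ = o + (t + d) % v
        P₂ = o + (t + (d + d)) % v
        same : ∀ z → occ (o + (d + t + 0) % v) (o + (d + t + d) % v) (o + (d + t + (d + d)) % v) z ≡ occ P₀ P₁ P₂ z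
        same z rewrite r₀ | r₁ | r₂ = sym (occ-rotate P₀ P₁ P₂ z)

-- The blocks {t, t + e, Z} for t ∈ ℤ_m, with ℤ_m on the points 0, …, m − 1 and Z a point outside it

module EdgeFamily (V m : ℕ) .{{_ : NonZero m}} (Z e : ℕ) where

  open Cyclic m

  edge : ℕ → List (Block V)
  edge t = triple V ((t + 0) % m) ((t + e) % m) Z

  edges : List (Block V)
  edges = concatUpTo m edge

  module _ (m≤Z : m ≤ Z) (Z<V : Z < V) (0<e : 0 < e) (e<m : e < m) where

    private
      below-Z : ∀ t a → (t + a) % m < Z
      below-Z t a = <-≤-trans (m%n<n (t + a) m) m≤Z

    pairCount-edge : ∀ t (x y : Fin V) →
      pairCount (edge t) x y ≡ occ ((t + 0) % m) ((t + e) % m) Z (toℕ x) * occ ((t + 0) % m) ((t + e) % m) Z (toℕ y)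
    pairCount-edge t = pairCount-triple (<-trans (below-Z t 0) Z<V) (<-trans (below-Z t e) Z<V) Z<V
      (λ eq → <⇒≢ 0<e (translate-injective t (≤-<-trans z≤n e<m) e<m eq))
      (<⇒≢ (below-Z t 0)) (<⇒≢ (below-Z t e))

    occ-inside : ∀ t {z} → z < m → occ ((t + 0) % m) ((t + e) % m) Z z ≡ δ z ((t + 0) % m) + δ z ((t + e) % m)
    occ-inside t z<m = trans (cong (_ +_) (δ-≢ (<⇒≢ (<-≤-trans z<m m≤Z)))) (+-identityʳ _)

    occ-outside : ∀ t {z} → m ≤ z → occ ((t + 0) % m) ((t + e) % m) Z z ≡ δ z Z
    occ-outside t m≤z = cong₂ (λ a b → a + b + _) (δ-≢ (away 0)) (δ-≢ (away e))
      where
      away : ∀ a → _ ≢ (t + a) % m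
      away a eq = <⇒≱ (m%n<n (t + a) m) (subst (m ≤_) eq m≤z)

    pairCount-edges-inside : ∀ (x y : Fin V) → toℕ x < m → toℕ y < m → toℕ x ≢ toℕ y →
      pairCount edges x y ≡ Δ± e (toℕ x) (toℕ y)
    pairCount-edges-inside x y x<m y<m x≢y = begin
        pairCount edges x y
      ≡⟨ pairCount-concatUpTo m edge x y ⟩
        ∑ m (λ t → pairCount (edge t) x y)
      ≡⟨ ∑-cong m (λ t _ → trans (pairCount-edge t x y) (trans (cong₂ _*_ (occ-inside t x<m) (occ-inside t y<m)) (regroup t))) ⟩
        ∑ m (λ t → X 0 t * Y e t + Y 0 t * X e t)
      ≡⟨ ∑-δ-translate-+ x<m y<m 0 e 0 e ⟩
        Δ± e (toℕ x) (toℕ y) ∎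
      where
      open ≡-Reasoning
      X Y : ℕ → ℕ → ℕ
      X a t = δ (toℕ x) ((t + a) % m)
      Y a t = δ (toℕ y) ((t + a) % m)
      regroup : ∀ t → (X 0 t + X e t) * (Y 0 t + Y e t) ≡ X 0 t * Y e t + Y 0 t * X e t
      regroup t = begin
          (X 0 t + X e t) * (Y 0 t + Y e t)
        ≡⟨ solve 4 (λ a b p q → (a :+ b) :* (p :+ q) := (a :* q :+ p :* b) :+ (a :* p :+ b :* q)) refl (X 0 t) (X e t) (Y 0 t) (Y e t) ⟩
          (X 0 t * Y e t + Y 0 t * X e t) + (X 0 t * Y 0 t + X e t * Y e t)
        ≡⟨ cong ((X 0 t * Y e t + Y 0 t * X e t) +_) (cong₂ _+_ (δ*δ-≢ x≢y _) (δ*δ-≢ x≢y _)) ⟩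
          (X 0 t * Y e t + Y 0 t * X e t) + 0
        ≡⟨ +-identityʳ _ ⟩
          X 0 t * Y e t + Y 0 t * X e t ∎

    pairCount-edges-across : ∀ (x y : Fin V) → toℕ x < m → m ≤ toℕ y → pairCount edges x y ≡ 2 * δ (toℕ y) Z
    pairCount-edges-across x y x<m m≤y = begin
        pairCount edges x y
      ≡⟨ pairCount-concatUpTo m edge x y ⟩
        ∑ m (λ t → pairCount (edge t) x y)
      ≡⟨ ∑-cong m (λ t _ → trans (pairCount-edge t x y) (trans (cong₂ _*_ (occ-inside t x<m) (occ-outside t m≤y)) (*-comm (X t) _))) ⟩
        ∑ m (λ t → δ (toℕ y) Z * X t)
      ≡⟨ ∑-*ˡ m (δ (toℕ y) Z) X ⟩
        δ (toℕ y) Z * ∑ m X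
      ≡⟨ cong (δ (toℕ y) Z *_) (trans (∑-distrib-+ m _ _) (cong₂ _+_ (∑-δ-translate₁ 0 x<m) (∑-δ-translate₁ e x<m))) ⟩
        δ (toℕ y) Z * 2
      ≡⟨ *-comm (δ (toℕ y) Z) 2 ⟩
        2 * δ (toℕ y) Z ∎
      where
      open ≡-Reasoning
      X : ℕ → ℕ
      X t = δ (toℕ x) ((t + 0) % m) + δ (toℕ x) ((t + e) % m)

    pairCount-edges-outside : ∀ (x y : Fin V) → m ≤ toℕ x → m ≤ toℕ y → toℕ x ≢ toℕ y → pairCount edges x y ≡ 0
    pairCount-edges-outside x y m≤x m≤y x≢y = trans (pairCount-concatUpTo m edge x y) (∑-zero m (λ t _ →
      trans (pairCount-edge t x y) (trans (cong₂ _*_ (occ-outside t m≤x) (occ-outside t m≤y)) (δ*δ-≢ x≢y Z))))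

-- The design: M = ℤ_m on 0, …, m − 1 and N = ℤ_n on m, …, m + n − 1, with m = 2k + 1, n = 2l + 1, λ = 2h

module Construction (k′ l h c r p : ℕ) where

  k m n V d₀ w : ℕ
  k = suc k′
  m = suc (k + k)
  n = suc (l + l)
  V = m + n
  d₀ = suc p
  w = k′ ∸ c

  -- σ enumerates the differences 1, …, k other than d₀.
  σ : ℕ → ℕ
  σ q = suc (punchIn p q)

  edgesAt : ℕ → ℕ → List (Block V)
  edgesAt j e = EdgeFamily.edges V m (m + j % n) e

  -- Slots j < nh = 3c + r + 1 carry the differences (σ q, σ q, 2σ q) for q < c, then a prefix of (d₀, d₀, 2d₀).
  regularSlots finalSlot : ℕ → List (Block V)
  regularSlots q = concatUpTo 3 (λ i → edgesAt (q * 3 + i) (triad (σ q) i))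
  finalSlot i = edgesAt (c * 3 + i) (triad d₀ i)

  edgeFamilies : List (Block V)
  edgeFamilies = concatUpTo c regularSlots ++ concatUpTo (suc r) finalSlot

  orbitsM shortOrbitsM orbitsN design : List (Block V)
  orbitsM = concatUpTo w (λ q → Development.orbit V m 0 (σ (c + q)))
  shortOrbitsM = concatUpTo (2 ∸ r) (λ _ → Development.shortOrbit V m 0 d₀)
  orbitsN = concatUpTo l (λ q → Development.orbit V n m (suc q))
  design = orbitsM ++ shortOrbitsM ++ edgeFamilies ++ orbitsN

  pairCount-design : ∀ x y → pairCount design x y ≡
    pairCount orbitsM x y + (pairCount shortOrbitsM x y + (pairCount edgeFamilies x y + pairCount orbitsN x y))
  pairCount-design x y = trans (pairCount-++ orbitsM _ x y) (cong (pairCount orbitsM x y +_)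
    (trans (pairCount-++ shortOrbitsM _ x y) (cong (pairCount shortOrbitsM x y +_) (pairCount-++ edgeFamilies orbitsN x y))))

  module _ (nh≡c*3+r+1 : n * h ≡ c * 3 + suc r) (r≤2 : r ≤ 2) (c≤k′ : c ≤ k′) (p≤k′ : p ≤ k′)
           (3d₀≡m : r < 2 → d₀ + d₀ + d₀ ≡ m) where

    private
      2d<m : ∀ {d} → d ≤ k → d + d < m
      2d<m d≤k = s≤s (+-mono-≤ d≤k d≤k)

      σ≤k : ∀ {q} → q < k′ → σ q ≤ k
      σ≤k {q} q<k′ = s≤s (≤-trans (punchIn-≤ p q) q<k′)

      d₀≤k : d₀ ≤ k
      d₀≤k = s≤s p≤k′

      triad<m : ∀ {d} i → d ≤ k → triad d i < m
      triad<m {d} i d≤k = ≤-<-trans (triad-≤ d i) (2d<m d≤k)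

      M⊆V : 0 + m ≤ V
      M⊆V = m≤m+n m n

      N⊆V : m + n ≤ V
      N⊆V = ≤-refl

    ∑-slots : ∀ (g : ℕ → ℕ) → ∑ c (λ q → ∑ 3 (λ i → g (q * 3 + i))) + ∑ (suc r) (λ i → g (c * 3 + i)) ≡ ∑ (n * h) g
    ∑-slots g = begin
        ∑ c (λ q → ∑ 3 (λ i → g (q * 3 + i))) + ∑ (suc r) (λ i → g (c * 3 + i))
      ≡⟨ cong (_+ ∑ (suc r) (λ i → g (c * 3 + i))) (∑-rows c 3 g) ⟨
        ∑ (c * 3) g + ∑ (suc r) (λ i → g (c * 3 + i))
      ≡⟨ ∑-+ (c * 3) (suc r) g ⟨
        ∑ (c * 3 + suc r) g
      ≡⟨ cong (λ z → ∑ z g) nh≡c*3+r+1 ⟨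
        ∑ (n * h) g ∎
      where open ≡-Reasoning

    pairCount-edgeFamilies : ∀ (x y : Fin V) (P : ℕ → ℕ → ℕ) →
      (∀ j e → 0 < e → e < m → pairCount (edgesAt j e) x y ≡ P j e) →
      pairCount edgeFamilies x y ≡ ∑ c (λ q → ∑ 3 (λ i → P (q * 3 + i) (triad (σ q) i))) + ∑ (suc r) (λ i → P (c * 3 + i) (triad d₀ i))
    pairCount-edgeFamilies x y P count = begin
        pairCount edgeFamilies x y
      ≡⟨ pairCount-++ (concatUpTo c regularSlots) (concatUpTo (suc r) finalSlot) x y ⟩
        pairCount (concatUpTo c regularSlots) x y + pairCount (concatUpTo (suc r) finalSlot) x y
      ≡⟨ cong₂ _+_ (trans (pairCount-concatUpTo c regularSlots x y) (∑-cong c regular-count))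
                   (trans (pairCount-concatUpTo (suc r) finalSlot x y) (∑-cong (suc r) final-count)) ⟩
        ∑ c (λ q → ∑ 3 (λ i → P (q * 3 + i) (triad (σ q) i))) + ∑ (suc r) (λ i → P (c * 3 + i) (triad d₀ i)) ∎
      where
      open ≡-Reasoning
      regular-count : ∀ q → q < c → pairCount (regularSlots q) x y ≡ ∑ 3 (λ i → P (q * 3 + i) (triad (σ q) i))
      regular-count q q<c = trans (pairCount-concatUpTo 3 (λ i → edgesAt (q * 3 + i) (triad (σ q) i)) x y)
        (∑-cong 3 (λ i _ → count (q * 3 + i) (triad (σ q) i) (triad-pos i (s≤s z≤n)) (triad<m i (σ≤k (<-≤-trans q<c c≤k′)))))
      final-count : ∀ i → i < suc r → pairCount (finalSlot i) x y ≡ P (c * 3 + i) (triad d₀ i)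
      final-count i _ = count (c * 3 + i) (triad d₀ i) (triad-pos i (s≤s z≤n)) (triad<m i d₀≤k)

    private
      c+q<k′ : ∀ {q} → q < w → c + q < k′
      c+q<k′ {q} q<w = subst (c + q <_) (m+[n∸m]≡n c≤k′) (+-monoʳ-< c q<w)

      Z-bounds : ∀ j → m ≤ m + j % n × m + j % n < V
      Z-bounds j = m≤m+n m (j % n) , +-monoʳ-< m (m%n<n j n)

    module PairInM (x y : Fin V) (x<m : toℕ x < m) (y<m : toℕ y < m) (x≢y : toℕ x ≢ toℕ y) where

      open Cyclic m using (Δ±; Δ±-double)

      X Y : ℕ
      X = toℕ x
      Y = toℕ y

      g : ℕ → ℕ
      g d = 2 * Δ± d X Y + Δ± (d + d) X Y

      orbitsM-count : pairCount orbitsM x y ≡ ∑ w (λ q → g (σ (c + q)))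
      orbitsM-count = trans (pairCount-concatUpTo w _ x y) (∑-cong w (λ q q<w →
        Development.pairCount-orbit V m 0 (σ (c + q)) M⊆V (s≤s z≤n) (2d<m (σ≤k (c+q<k′ q<w))) x y refl refl x<m y<m x≢y))

      shortOrbitsM-count : pairCount shortOrbitsM x y ≡ (2 ∸ r) * Δ± d₀ X Y
      shortOrbitsM-count = trans (pairCount-concatUpTo (2 ∸ r) _ x y) (trans (∑-const (2 ∸ r) _) padded)
        where
        padded : (2 ∸ r) * pairCount (Development.shortOrbit V m 0 d₀) x y ≡ (2 ∸ r) * Δ± d₀ X Y
        padded with r <? 2
        ... | yes r<2 = cong ((2 ∸ r) *_)
          (Development.pairCount-shortOrbit V m 0 d₀ M⊆V (s≤s z≤n) (2d<m d₀≤k) (3d₀≡m r<2) x y refl refl x<m y<m x≢y)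
        ... | no r≮2 rewrite m≤n⇒m∸n≡0 (≮⇒≥ r≮2) = refl

      edgeFamilies-count : pairCount edgeFamilies x y ≡ ∑ c (λ q → g (σ q)) + ∑ (suc r) (λ i → Δ± (triad d₀ i) X Y)
      edgeFamilies-count = trans (pairCount-edgeFamilies x y (λ _ e → Δ± e X Y) inside)
        (cong (_+ ∑ (suc r) (λ i → Δ± (triad d₀ i) X Y)) (∑-cong c (λ q _ → ∑-triad (λ e → Δ± e X Y) (σ q))))
        where
        inside : ∀ j e → 0 < e → e < m → pairCount (edgesAt j e) x y ≡ Δ± e X Y
        inside j e 0<e e<m = EdgeFamily.pairCount-edges-inside V m (m + j % n) e (proj₁ (Z-bounds j)) (proj₂ (Z-bounds j)) 0<e e<m
                               x y x<m y<m x≢y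

      orbitsN-count : pairCount orbitsN x y ≡ 0
      orbitsN-count = trans (pairCount-concatUpTo l _ x y) (∑-zero l (λ q q<l →
        Development.pairCount-outside V n m (suc q) N⊆V (s≤s z≤n) (s≤s (+-mono-≤ q<l q<l)) n x y (inj₁ x<m)))

      budget : ∑ k′ (λ q → g (σ q)) + g d₀ ≡ 3
      budget = begin
          ∑ k′ (λ q → g (σ q)) + g d₀
        ≡⟨ cong (λ z → ∑ z (λ q → g (σ q)) + g d₀) (m+[n∸m]≡n p≤k′) ⟨
          ∑ (p + (k′ ∸ p)) (λ q → g (suc (punchIn p q))) + g (suc p)
        ≡⟨ ∑-punchIn p (k′ ∸ p) (λ d → g (suc d)) ⟩
          ∑ (suc (p + (k′ ∸ p))) (λ d → g (suc d))
        ≡⟨ cong (λ z → ∑ (suc z) (λ d → g (suc d))) (m+[n∸m]≡n p≤k′) ⟩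
          ∑ k (λ d → 2 * Δ± (suc d) X Y + Δ± (suc d + suc d) X Y)
        ≡⟨ ∑-distrib-+ k _ _ ⟩
          ∑ k (λ d → 2 * Δ± (suc d) X Y) + ∑ k (λ d → Δ± (suc d + suc d) X Y)
        ≡⟨ cong₂ _+_ (trans (∑-*ˡ k 2 _) (cong (2 *_) (OddCycle.∑-Δ±₁ k x<m y<m x≢y))) (OddCycle.∑-Δ±₂ k x<m y<m x≢y) ⟩
          3 ∎
        where open ≡-Reasoning

      count : pairCount design x y ≡ 3
      count = begin
          pairCount design x y
        ≡⟨ pairCount-design x y ⟩
          pairCount orbitsM x y + (pairCount shortOrbitsM x y + (pairCount edgeFamilies x y + pairCount orbitsN x y))
        ≡⟨ cong₂ _+_ orbitsM-count (cong₂ _+_ shortOrbitsM-count (cong₂ _+_ edgeFamilies-count orbitsN-count)) ⟩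
          Σw + (S + ((Σc + T) + 0))
        ≡⟨ solve 4 (λ a b c e → a :+ (b :+ ((c :+ e) :+ con 0)) := (c :+ a) :+ (b :+ e)) refl Σw S Σc T ⟩
          (Σc + Σw) + (S + T)
        ≡⟨ cong₂ _+_ (sym (∑-+ c w (λ q → g (σ q))))
                     (∑-triad-padded (λ e → Δ± e X Y) d₀ r r≤2 (λ r<2 → Δ±-double (3d₀≡m r<2) x<m y<m)) ⟩
          ∑ (c + w) (λ q → g (σ q)) + g d₀
        ≡⟨ cong (λ z → ∑ z (λ q → g (σ q)) + g d₀) (m+[n∸m]≡n c≤k′) ⟩
          ∑ k′ (λ q → g (σ q)) + g d₀
        ≡⟨ budget ⟩
          3 ∎
        where
        open ≡-Reasoning
        Σw = ∑ w (λ q → g (σ (c + q)))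
        S = (2 ∸ r) * Δ± d₀ X Y
        Σc = ∑ c (λ q → g (σ q))
        T = ∑ (suc r) (λ i → Δ± (triad d₀ i) X Y)

    module _ (x y : Fin V) where

      orbitsM-outside : m ≤ toℕ x → pairCount orbitsM x y ≡ 0
      orbitsM-outside m≤x = trans (pairCount-concatUpTo w _ x y) (∑-zero w (λ q q<w →
        Development.pairCount-outside V m 0 (σ (c + q)) M⊆V (s≤s z≤n) (2d<m (σ≤k (c+q<k′ q<w))) m x y (inj₂ m≤x)))

      shortOrbitsM-outside : m ≤ toℕ x → pairCount shortOrbitsM x y ≡ 0
      shortOrbitsM-outside m≤x = trans (pairCount-concatUpTo (2 ∸ r) _ x y) (∑-zero (2 ∸ r) (λ _ _ →
        Development.pairCount-outside V m 0 d₀ M⊆V (s≤s z≤n) (2d<m d₀≤k) d₀ x y (inj₂ m≤x)))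

      orbitsN-outside : toℕ x < m → pairCount orbitsN x y ≡ 0
      orbitsN-outside x<m = trans (pairCount-concatUpTo l _ x y) (∑-zero l (λ q q<l →
        Development.pairCount-outside V n m (suc q) N⊆V (s≤s z≤n) (s≤s (+-mono-≤ q<l q<l)) n x y (inj₁ x<m)))

    module PairInN (x y : Fin V) (m≤x : m ≤ toℕ x) (m≤y : m ≤ toℕ y) (x≢y : toℕ x ≢ toℕ y) where

      open Cyclic n using (Δ±)

      X′ Y′ : ℕ
      X′ = toℕ x ∸ m
      Y′ = toℕ y ∸ m

      edgeFamilies-count : pairCount edgeFamilies x y ≡ 0
      edgeFamilies-count = begin
          pairCount edgeFamilies x y
        ≡⟨ pairCount-edgeFamilies x y (λ _ _ → 0) (λ j e 0<e e<m →
             EdgeFamily.pairCount-edges-outside V m (m + j % n) e (proj₁ (Z-bounds j)) (proj₂ (Z-bounds j)) 0<e e<m x y m≤x m≤y x≢y) ⟩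
          ∑ c (λ q → ∑ 3 (λ i → 0)) + ∑ (suc r) (λ i → 0)
        ≡⟨ ∑-slots (λ _ → 0) ⟩
          ∑ (n * h) (λ _ → 0)
        ≡⟨ ∑-zero (n * h) (λ _ _ → refl) ⟩
          0 ∎
        where open ≡-Reasoning

      orbitsN-count : pairCount orbitsN x y ≡ 3
      orbitsN-count = begin
          pairCount orbitsN x y
        ≡⟨ pairCount-concatUpTo l _ x y ⟩
          ∑ l (λ q → pairCount (Development.orbit V n m (suc q)) x y)
        ≡⟨ ∑-cong l (λ q q<l → Development.pairCount-orbit V n m (suc q) N⊆V (s≤s z≤n) (s≤s (+-mono-≤ q<l q<l))
                                  x y (in-N m≤x) (in-N m≤y) (below-n x) (below-n y) (λ eq → x≢y (shift-injective eq))) ⟩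
          ∑ l (λ q → 2 * Δ± (suc q) X′ Y′ + Δ± (suc q + suc q) X′ Y′)
        ≡⟨ ∑-distrib-+ l _ _ ⟩
          ∑ l (λ q → 2 * Δ± (suc q) X′ Y′) + ∑ l (λ q → Δ± (suc q + suc q) X′ Y′)
        ≡⟨ cong₂ _+_ (trans (∑-*ˡ l 2 _) (cong (2 *_) (OddCycle.∑-Δ±₁ l (below-n x) (below-n y) (λ eq → x≢y (shift-injective eq)))))
                     (OddCycle.∑-Δ±₂ l (below-n x) (below-n y) (λ eq → x≢y (shift-injective eq))) ⟩
          3 ∎
        where
        open ≡-Reasoning
        in-N : ∀ {z} → m ≤ z → z ≡ m + (z ∸ m)
        in-N m≤z = sym (m+[n∸m]≡n m≤z)
        below-n : ∀ (z : Fin V) → toℕ z ∸ m < n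
        below-n z = m<n+o⇒m∸n<o (toℕ z) m (toℕ<n z)
        shift-injective : X′ ≡ Y′ → toℕ x ≡ toℕ y
        shift-injective eq = trans (in-N m≤x) (trans (cong (m +_) eq) (sym (in-N m≤y)))

      count : pairCount design x y ≡ 3
      count = begin
          pairCount design x y
        ≡⟨ pairCount-design x y ⟩
          pairCount orbitsM x y + (pairCount shortOrbitsM x y + (pairCount edgeFamilies x y + pairCount orbitsN x y))
        ≡⟨ cong₂ _+_ (orbitsM-outside x y m≤x) (cong₂ _+_ (shortOrbitsM-outside x y m≤x) (cong₂ _+_ edgeFamilies-count orbitsN-count)) ⟩
          3 ∎
        where open ≡-Reasoning

    module PairAcross (x y : Fin V) (x<m : toℕ x < m) (m≤y : m ≤ toℕ y) where

      -- Each point of N is the apex of exactly h edge families, and each edge family through it covers every x ∈ M twice.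
      ∑-apex : ∑ (n * h) (λ j → δ (toℕ y) (m + j % n)) ≡ h
      ∑-apex = begin
          ∑ (n * h) f
        ≡⟨ cong (λ z → ∑ z f) (*-comm n h) ⟩
          ∑ (h * n) f
        ≡⟨ ∑-periodic h n f (λ t → cong (λ z → δ (toℕ y) (m + z)) (trans (cong (_% n) (+-comm n t)) ([m+n]%n≡m%n t n))) ⟩
          h * ∑ n f
        ≡⟨ cong (h *_) (∑-cong n (λ j j<n → trans (cong (δ (toℕ y)) (cong (m +_) (m<n⇒m%n≡m j<n)))
                                                   (trans (cong (λ z → δ z (m + j)) y≡m+Y′) (δ-+ˡ m Y′ j)))) ⟩
          h * ∑ n (δ Y′)
        ≡⟨ cong (h *_) (∑-δ₁ n Y′ (m<n+o⇒m∸n<o (toℕ y) m (toℕ<n y))) ⟩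
          h * 1
        ≡⟨ *-identityʳ h ⟩
          h ∎
        where
        open ≡-Reasoning
        f : ℕ → ℕ
        f j = δ (toℕ y) (m + j % n)
        Y′ = toℕ y ∸ m
        y≡m+Y′ : toℕ y ≡ m + Y′
        y≡m+Y′ = sym (m+[n∸m]≡n m≤y)

      edgeFamilies-count : pairCount edgeFamilies x y ≡ h + h
      edgeFamilies-count = begin
          pairCount edgeFamilies x y
        ≡⟨ pairCount-edgeFamilies x y (λ j _ → 2 * δ (toℕ y) (m + j % n)) (λ j e 0<e e<m →
             EdgeFamily.pairCount-edges-across V m (m + j % n) e (proj₁ (Z-bounds j)) (proj₂ (Z-bounds j)) 0<e e<m x y x<m m≤y) ⟩
          _
        ≡⟨ ∑-slots (λ j → 2 * δ (toℕ y) (m + j % n)) ⟩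
          ∑ (n * h) (λ j → 2 * δ (toℕ y) (m + j % n))
        ≡⟨ ∑-*ˡ (n * h) 2 _ ⟩
          2 * ∑ (n * h) (λ j → δ (toℕ y) (m + j % n))
        ≡⟨ cong (2 *_) ∑-apex ⟩
          2 * h
        ≡⟨ cong (h +_) (+-identityʳ h) ⟩
          h + h ∎
        where open ≡-Reasoning

      count : pairCount design x y ≡ h + h
      count = begin
          pairCount design x y
        ≡⟨ pairCount-design x y ⟩
          pairCount orbitsM x y + (pairCount shortOrbitsM x y + (pairCount edgeFamilies x y + pairCount orbitsN x y))
        ≡⟨ cong₂ _+_ (trans (pairCount-sym orbitsM x y) (orbitsM-outside y x m≤y))
                     (cong₂ _+_ (trans (pairCount-sym shortOrbitsM x y) (shortOrbitsM-outside y x m≤y))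
                                (cong₂ _+_ edgeFamilies-count (orbitsN-outside x y x<m))) ⟩
          h + h + 0
        ≡⟨ +-identityʳ (h + h) ⟩
          h + h ∎
        where open ≡-Reasoning

    isGDD : IsGDD m n 3 (h + h) design
    isGDD x y x≢y with toℕ x <? m | toℕ y <? m
    ... | yes x<m | yes y<m = (λ _ → PairInM.count x y x<m y<m (x≢y ∘′ toℕ-injective))
                           , (λ apart → ⊥-elim (apart (inj₁ (x<m , y<m))))
    ... | no x≮m | no y≮m = (λ _ → PairInN.count x y (≮⇒≥ x≮m) (≮⇒≥ y≮m) (x≢y ∘′ toℕ-injective))
                         , (λ apart → ⊥-elim (apart (inj₂ (x≮m , y≮m))))
    ... | yes x<m | no y≮m = (λ { (inj₁ (_ , y<m)) → ⊥-elim (y≮m y<m) ; (inj₂ (x≮m , _)) → ⊥-elim (x≮m x<m) })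
                           , (λ _ → PairAcross.count x y x<m (≮⇒≥ y≮m))
    ... | no x≮m | yes y<m = (λ { (inj₁ (x<m , _)) → ⊥-elim (x≮m x<m) ; (inj₂ (_ , y≮m)) → ⊥-elim (y≮m y<m) })
                           , (λ _ → trans (pairCount-sym design x y) (PairAcross.count y x y<m (≮⇒≥ x≮m)))

-- Choice of the parameters

HasGDD : (m n λ₁ λ₂ : ℕ) → Set
HasGDD m n λ₁ λ₂ = Σ (List (Block (m + n))) (IsGDD m n λ₁ λ₂)

3-prime : Prime 3
3-prime = toWitness {a? = prime? 3} _

2-prime : Prime 2
2-prime = toWitness {a? = prime? 2} _

3∤m⇒3∣nh : ∀ h m n → 3 ∣ (h + h) * m * n → ¬ 3 ∣ m → 3 ∣ n * h
3∤m⇒3∣nh h m n 3∣2hmn 3∤m with euclidsLemma ((h + h) * m) n 3-prime 3∣2hmn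
... | inj₂ 3∣n = ∣-trans 3∣n (m∣m*n h)
... | inj₁ 3∣2hm with euclidsLemma (h + h) m 3-prime 3∣2hm
...   | inj₂ 3∣m = ⊥-elim (3∤m 3∣m)
...   | inj₁ 3∣2h with euclidsLemma 2 h 3-prime (subst (3 ∣_) (cong (h +_) (sym (+-identityʳ h))) 3∣2h)
...     | inj₁ 3∣2 = ⊥-elim (<⇒≱ (s≤s (s≤s (s≤s z≤n))) (∣⇒≤ 3∣2))
...     | inj₂ 3∣h = ∣-trans 3∣h (n∣m*n n)

module Existence (k′ l h : ℕ) where

  k m n L c r : ℕ
  k = suc k′
  m = suc (k + k)
  n = suc (l + l)
  L = n * h
  c = (L ∸ 1) / 3
  r = (L ∸ 1) % 3

  module _ (0<h : 0 < h) (2hn≤6k : (h + h) * n ≤ 3 * (k + k)) (3∣2hmn : 3 ∣ (h + h) * m * n) where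

    L≡c*3+r+1 : L ≡ c * 3 + suc r
    L≡c*3+r+1 = begin
        L
      ≡⟨ suc-pred L {{>-nonZero (*-mono-≤ {1} {n} (s≤s z≤n) 0<h)}} ⟨
        suc (L ∸ 1)
      ≡⟨ cong suc (m≡m%n+[m/n]*n (L ∸ 1) 3) ⟩
        suc (r + c * 3)
      ≡⟨ solve 2 (λ r c → con 1 :+ (r :+ c) := c :+ (con 1 :+ r)) refl r (c * 3) ⟩
        c * 3 + suc r ∎
      where open ≡-Reasoning

    r≤2 : r ≤ 2
    r≤2 = ≤-pred (m%n<n (L ∸ 1) 3)

    L≤3k : L ≤ 3 * k
    L≤3k = *-cancelˡ-≤ 2 (subst₂ _≤_ (solve 2 (λ h n → (h :+ h) :* n := con 2 :* (n :* h)) refl h n)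
                                    (solve 1 (λ k → con 3 :* (k :+ k) := con 2 :* (con 3 :* k)) refl k) 2hn≤6k)

    c≤k′ : c ≤ k′
    c≤k′ = ≤-pred (*-cancelʳ-< 3 c k (begin-strict
        c * 3
      <⟨ m<m+n (c * 3) (s≤s z≤n) ⟩
        c * 3 + suc r
      ≡⟨ L≡c*3+r+1 ⟨
        L
      ≤⟨ L≤3k ⟩
        3 * k
      ≡⟨ *-comm 3 k ⟩
        k * 3 ∎))
      where open ≤-Reasoning

    hasGDD-with : ∀ p → p ≤ k′ → (r < 2 → suc p + suc p + suc p ≡ m) → HasGDD m n 3 (h + h)
    hasGDD-with p p≤k′ 3d₀≡m = Construction.design k′ l h c r p , Construction.isGDD k′ l h c r p L≡c*3+r+1 r≤2 c≤k′ p≤k′ 3d₀≡m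

    hasGDD : HasGDD m n 3 (h + h)
    hasGDD with 3 ∣? m
    ... | yes 3∣m = hasGDD-with (d₀ ∸ 1) (∸-monoˡ-≤ 1 d₀≤k) (λ _ → 3d₀≡m)
      where
      d₀ = m / 3
      d₀*3≡m : d₀ * 3 ≡ m
      d₀*3≡m = m/n*n≡m 3∣m
      instance
        d₀≢0 : NonZero d₀
        d₀≢0 = ≢-nonZero (λ d₀≡0 → 0≢1+n (trans (sym (cong (_* 3) d₀≡0)) d₀*3≡m))
      3d₀≡m : suc (d₀ ∸ 1) + suc (d₀ ∸ 1) + suc (d₀ ∸ 1) ≡ m
      3d₀≡m = trans (cong (λ z → z + z + z) (suc-pred d₀)) (trans (solve 1 (λ d → d :+ d :+ d := d :* con 3) refl d₀) d₀*3≡m)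
      d₀≤k : d₀ ≤ k
      d₀≤k = *-cancelʳ-≤ d₀ k 3 (begin
          d₀ * 3
        ≡⟨ d₀*3≡m ⟩
          suc (k + k)
        ≡⟨ +-comm 1 (k + k) ⟩
          k + k + 1
        ≤⟨ +-monoʳ-≤ (k + k) (s≤s (z≤n {k′})) ⟩
          k + k + k
        ≡⟨ solve 1 (λ k → k :+ k :+ k := k :* con 3) refl k ⟩
          k * 3 ∎)
        where open ≤-Reasoning
    ... | no 3∤m = hasGDD-with 0 z≤n (λ r<2 → ⊥-elim (<⇒≱ r<2 (≤-pred (∣⇒≤ 3∣1+r))))
      where
      3∣1+r : 3 ∣ suc r
      3∣1+r = ∣m+n∣m⇒∣n (subst (3 ∣_) L≡c*3+r+1 (3∤m⇒3∣nh h m n 3∣2hmn 3∤m)) (n∣m*n c)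

odd⇒≡1+2* : ∀ a → ¬ 2 ∣ a → Σ ℕ (λ q → a ≡ suc (q + q))
odd⇒≡1+2* a 2∤a with a % 2 in a%2≡ | m%n<n a 2
... | 0 | _ = ⊥-elim (2∤a (m%n≡0⇒n∣m a 2 a%2≡))
... | 1 | _ = a / 2 , trans (m≡m%n+[m/n]*n a 2) (trans (cong (_+ a / 2 * 2) a%2≡)
                           (cong suc (solve 1 (λ q → q :* con 2 := q :+ q) refl (a / 2))))
... | suc (suc _) | s≤s (s≤s ())

even⇒≡2* : ∀ {a} → 2 ∣ a → Σ ℕ (λ q → a ≡ q + q)
even⇒≡2* (divides q a≡q*2) = q , trans a≡q*2 (solve 1 (λ q → q :* con 2 := q :+ q) refl q)

2∣l+l+λm⇒2∣λ : ∀ l λ′ m → ¬ 2 ∣ m → 2 ∣ l + l + λ′ * m → 2 ∣ λ′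
2∣l+l+λm⇒2∣λ l λ′ m 2∤m 2∣l+l+λm with euclidsLemma λ′ m 2-prime
  (∣m+n∣m⇒∣n 2∣l+l+λm (divides l (solve 1 (λ l → l :+ l := l :* con 2) refl l)))
... | inj₁ 2∣λ = 2∣λ
... | inj₂ 2∣m = ⊥-elim (2∤m 2∣m)

lemma6 : (λ' m n : ℕ) → .{{_ : NonZero n}} → 4 ≤ λ' → n < m → ¬ 2 ∣ m → ¬ 2 ∣ n →
    3 ∣ λ' * m * n → 2 ∣ n ∸ 1 + λ' * m → 2 ∣ m ∸ 1 + λ' * n →
    λ' ≤ (3 * (m ∸ 1)) / n →
    Σ (List (Block (m + n))) (λ 𝓑 → IsGDD m n 3 λ' 𝓑)
lemma6 λ' m n 4≤λ n<m 2∤m 2∤n 3∣λmn 2∣n∸1+λm _ λ≤⌊3[m∸1]/n⌋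
  with odd⇒≡1+2* m 2∤m | odd⇒≡1+2* n 2∤n
... | zero , refl | l , refl = ⊥-elim (<⇒≱ n<m (s≤s z≤n))
... | suc k′ , refl | l , refl with even⇒≡2* (2∣l+l+λm⇒2∣λ l λ' m 2∤m 2∣n∸1+λm)
...   | zero , refl = ⊥-elim (<⇒≱ (s≤s z≤n) 4≤λ)
...   | h@(suc _) , refl = Existence.hasGDD k′ l h (s≤s z≤n) λn≤3[m∸1] 3∣λmn
  where
  λn≤3[m∸1] : (h + h) * n ≤ 3 * (m ∸ 1)
  λn≤3[m∸1] = ≤-trans (*-monoˡ-≤ n λ≤⌊3[m∸1]/n⌋) (m/n*n≤m (3 * (m ∸ 1)) n)
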